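{- For every $n\geq 0$: $|\mathrm{Motz}(n)|=\mathrm{Cat}(n+1)$, $|\mathrm{Motz}^{\{1\}}(n)|=\mathrm{Cat}(n)$, $|\mathrm{Motz}^{\{2\}}(n)|=\mathrm{Cat}(n)$; and for every $n\geq 2$, $|\mathrm{Motz}^{\{1,2\}}(n)|=\mathrm{Cat}(n-1)$.
   Context: $\mathrm{Cat}(m)=\frac{1}{m+1}\binom{2m}{m}$. A bicolored Motzkin path of length $n$ is a lattice path from $(0,0)$ to $(n,0)$ with steps $U=(1,1)$, $D=(1,-1)$ and horizontal steps $(1,0)$, each horizontal step colored umber or denim, never going below the $x$-axis. $\mathrm{Motz}(n)$ is the set of all such paths; $\mathrm{Motz}^{\{1\}}(n)$ those satisfying restriction (1): no umber horizontal step at height zero; $\mathrm{Motz}^{\{2\}}(n)$ those satisfying restriction (2): no denim horizontal step occurs before the first down step; $\mathrm{Motz}^{\{1,2\}}(n)$ those satisfying both (1) and (2). -}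

module Defs where

open import Data.Nat using (ℕ; zero; suc; _+_; _*_; _∸_; _/_)
open import Data.Nat.Combinatorics using (_C_)
open import Data.Bool using (Bool; true; false; _∧_; not)
open import Data.List using (List; []; _∷_; length; filterᵇ; concatMap; map)

Cat : ℕ → ℕ
Cat m = ((2 * m) C m) / suc m

-- Steps of a bicolored Motzkin path: U = (1,1), D = (1,-1),
-- Hu = umber horizontal step, Hd = denim horizontal step.
data Step : Set where
  U D Hu Hd : Step

validFrom : ℕ → List Step → Bool
validFrom zero    []        = true
validFrom (suc h) []        = false
validFrom h       (U ∷ w)   = validFrom (suc h) w
validFrom zero    (D ∷ w)   = false
validFrom (suc h) (D ∷ w)   = validFrom h w
validFrom h       (Hu ∷ w)  = validFrom h w
validFrom h       (Hd ∷ w)  = validFrom h w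

isMotzkin : List Step → Bool
isMotzkin = validFrom 0

noUmberAt0From : ℕ → List Step → Bool
noUmberAt0From h       []        = true
noUmberAt0From h       (U ∷ w)   = noUmberAt0From (suc h) w
noUmberAt0From zero    (D ∷ w)   = noUmberAt0From zero w
noUmberAt0From (suc h) (D ∷ w)   = noUmberAt0From h w
noUmberAt0From zero    (Hu ∷ w)  = false
noUmberAt0From (suc h) (Hu ∷ w)  = noUmberAt0From (suc h) w
noUmberAt0From h       (Hd ∷ w)  = noUmberAt0From h w

restr1 : List Step → Bool
restr1 = noUmberAt0From 0

restr2 : List Step → Bool
restr2 []        = true
restr2 (D ∷ w)   = true
restr2 (Hd ∷ w)  = false
restr2 (U ∷ w)   = restr2 w
restr2 (Hu ∷ w)  = restr2 w

words : ℕ → List (List Step)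
words zero    = [] ∷ []
words (suc n) = concatMap (λ w → (U ∷ w) ∷ (D ∷ w) ∷ (Hu ∷ w) ∷ (Hd ∷ w) ∷ []) (words n)

countMotz : ℕ → ℕ
countMotz n = length (filterᵇ (λ w → isMotzkin w) (words n))

countMotz1 : ℕ → ℕ
countMotz1 n = length (filterᵇ (λ w → isMotzkin w ∧ restr1 w) (words n))

countMotz2 : ℕ → ℕ
countMotz2 n = length (filterᵇ (λ w → isMotzkin w ∧ restr2 w) (words n))

countMotz12 : ℕ → ℕ
countMotz12 n = length (filterᵇ (λ w → isMotzkin w ∧ (restr1 w ∧ restr2 w)) (words n))

-- Reading
-- U, D, Hd, Hu as the pairs of half-steps ↑↑, ↓↓, ↑↓, ↓↑ of a simple walk, the
-- reflection principle predicts the closed form  ballot d n h = C(2n, n+h) − C(2n, n+h+d),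
-- with d = 2 for Motz and d = 1 for Motz^{1} (and, as it turns out, for Motz^{2}).
-- Instead of constructing the bijection we check that these closed forms satisfy the
-- first-step recurrences of the counts: above height 0 this is Pascal's rule applied
-- twice, and at height 0 the forbidden steps are accounted for by the symmetry
-- C(2n+1, n) = C(2n+1, n+1).  A path in Motz^{1,2} must start with U, and those of
-- length n+1 from height h+1 are as many as the Motzkin paths of length n from height h.
-- Finally Cat n = C(2n, n) − C(2n, n+1).

module Submission where

open import Defs
open import Data.Nat using (ℕ; zero; suc; _∸_; _≥_; _+_; _*_; _≤_; z≤n; s≤s)
open import Data.Nat.Properties
  using (+-suc; +-assoc; *-suc; m≤m+n; m≤n+m; m+n∸m≡n; m+n∸n≡m; *-comm; *-distribˡ-∸; *-distribˡ-+; *-cancelˡ-≤; +-identityʳ; *-identityʳ; *-zeroʳ)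
open import Data.Nat.Combinatorics using (_C_; nCk+nC[k+1]≡[n+1]C[k+1]; nCk≡nC[n∸k]; k>n⇒nCk≡0; nC1≡n)
open import Data.Nat.DivMod using (_/_; m*n/n≡m)
import Data.Nat.Tactic.RingSolver as ℕ-Solver
open import Data.Integer as ℤ using (ℤ; +_; _⊖_)
open import Data.Integer.Properties as ℤ using (pos-+; +-injective; m-n≡m⊖n; ⊖-≥)
open import Data.Integer.Tactic.RingSolver using (solve-∀)
open import Data.Bool using (Bool; true; false; _∧_; T)
open import Data.Bool.Properties using (∧-zeroʳ; ∧-identityʳ)
open import Data.List using (List; []; _∷_; _++_; length; filterᵇ; concatMap; map)
open import Data.List.Properties using (map-++; filter-≐; filter-none)
open import Data.Nat.ListAction using (sum)
open import Data.Nat.ListAction.Properties using (sum-++)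
import Data.List.Relation.Unary.All as All
open import Data.Product using (_×_; _,_)
open import Function using (_∘_)
open import Relation.Binary.PropositionalEquality
open import Relation.Nullary.Decidable using (T?)

open ≡-Reasoning

-- Counting words by their first step

indicator : Bool → ℕ
indicator true  = 1
indicator false = 0

module _ {A : Set} (P : A → Bool) where

  length-filterᵇ : ∀ xs → length (filterᵇ P xs) ≡ sum (map (indicator ∘ P) xs)
  length-filterᵇ []       = refl
  length-filterᵇ (x ∷ xs) with P x
  ... | true  = cong suc (length-filterᵇ xs)
  ... | false = length-filterᵇ xs

  filterᵇ-none : (∀ x → P x ≡ false) → ∀ xs → filterᵇ P xs ≡ []
  filterᵇ-none P≡false xs = filter-none (T? ∘ P) (All.universal (λ x → subst T (P≡false x)) xs)

filterᵇ-≗ : ∀ {A : Set} {P Q : A → Bool} → (∀ x → P x ≡ Q x) → ∀ xs → filterᵇ P xs ≡ filterᵇ Q xs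
filterᵇ-≗ {P = P} {Q} P≗Q = filter-≐ (T? ∘ P) (T? ∘ Q) (subst T (P≗Q _) , subst T (sym (P≗Q _)))

extensions : List Step → List (List Step)
extensions w = (U ∷ w) ∷ (D ∷ w) ∷ (Hu ∷ w) ∷ (Hd ∷ w) ∷ []

sum-map-concatMap-extensions : ∀ (f : List Step → ℕ) ws →
  sum (map f (concatMap extensions ws)) ≡
  sum (map (f ∘ (U ∷_)) ws) + sum (map (f ∘ (D ∷_)) ws) + sum (map (f ∘ (Hu ∷_)) ws) + sum (map (f ∘ (Hd ∷_)) ws)
sum-map-concatMap-extensions f []       = refl
sum-map-concatMap-extensions f (w ∷ ws) = begin
  sum (map f (extensions w ++ concatMap extensions ws))
    ≡⟨ cong sum (map-++ f (extensions w) (concatMap extensions ws)) ⟩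
  sum (map f (extensions w) ++ map f (concatMap extensions ws))
    ≡⟨ sum-++ (map f (extensions w)) (map f (concatMap extensions ws)) ⟩
  sum (map f (extensions w)) + sum (map f (concatMap extensions ws))
    ≡⟨ cong (_+_ (sum (map f (extensions w)))) (sum-map-concatMap-extensions f ws) ⟩
  _ ≡⟨ interchange (f (U ∷ w)) (f (D ∷ w)) (f (Hu ∷ w)) (f (Hd ∷ w)) _ _ _ _ ⟩
  _ ∎
  where
  interchange : ∀ a b c d A B C D →
    a + (b + (c + (d + 0))) + (A + B + C + D) ≡ (a + A) + (b + B) + (c + C) + (d + D)
  interchange = ℕ-Solver.solve-∀

count : (List Step → Bool) → ℕ → ℕ
count P n = length (filterᵇ P (words n))

count-suc : ∀ P n → count P (suc n) ≡
  count (P ∘ (U ∷_)) n + count (P ∘ (D ∷_)) n + count (P ∘ (Hu ∷_)) n + count (P ∘ (Hd ∷_)) n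
count-suc P n = begin
  count P (suc n)
    ≡⟨ length-filterᵇ P (words (suc n)) ⟩
  sum (map (indicator ∘ P) (words (suc n)))
    ≡⟨ sum-map-concatMap-extensions (indicator ∘ P) (words n) ⟩
  _ ≡⟨ cong₂ _+_ (cong₂ _+_ (cong₂ _+_ (length-filterᵇ _ (words n)) (length-filterᵇ _ (words n)))
                              (length-filterᵇ _ (words n))) (length-filterᵇ _ (words n)) ⟨
  _ ∎

count-≗ : ∀ {P Q} → (∀ w → P w ≡ Q w) → ∀ n → count P n ≡ count Q n
count-≗ P≗Q n = cong length (filterᵇ-≗ P≗Q (words n))

count-none : ∀ {P} → (∀ w → P w ≡ false) → ∀ n → count P n ≡ 0
count-none {P} P≡false n = cong length (filterᵇ-none P P≡false (words n))

-- Binomial coefficients and Catalan numbers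

[m+n]Cm≡[m+n]Cn : ∀ m n → (m + n) C m ≡ (m + n) C n
[m+n]Cm≡[m+n]Cn m n = trans (nCk≡nC[n∸k] (m≤m+n m n)) (cong ((m + n) C_) (m+n∸m≡n m n))

[1+2n]Cn≡[1+2n]C[1+n] : ∀ n → suc (2 * n) C n ≡ suc (2 * n) C suc n
[1+2n]Cn≡[1+2n]C[1+n] n = subst (λ N → N C n ≡ N C suc n) n+[1+n]≡1+2n ([m+n]Cm≡[m+n]Cn n (suc n))
  where
  n+[1+n]≡1+2n : n + suc n ≡ suc (2 * n)
  n+[1+n]≡1+2n = trans (+-suc n n) (cong (λ m → suc (n + m)) (sym (+-identityʳ n)))

pascal : ∀ n k → suc n C suc k ≡ n C k + n C suc k
pascal n k = sym (nCk+nC[k+1]≡[n+1]C[k+1] n k)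

[1+k]*[1+n]C[1+k]≡[1+n]*nCk : ∀ n k → suc k * (suc n C suc k) ≡ suc n * (n C k)
[1+k]*[1+n]C[1+k]≡[1+n]*nCk n       zero    = trans (+-identityʳ _) (trans (nC1≡n (suc n)) (sym (*-identityʳ _)))
[1+k]*[1+n]C[1+k]≡[1+n]*nCk zero    (suc k)
  rewrite k>n⇒nCk≡0 {1} {2 + k} (s≤s (s≤s z≤n)) | k>n⇒nCk≡0 {0} {suc k} (s≤s z≤n) = *-zeroʳ (2 + k)
[1+k]*[1+n]C[1+k]≡[1+n]*nCk (suc n) (suc k) = begin
  (2 + k) * (suc (suc n) C (2 + k))         ≡⟨ cong ((2 + k) *_) (pascal (suc n) (suc k)) ⟩
  (2 + k) * (A + B)                         ≡⟨ *-distribˡ-+ (2 + k) A B ⟩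
  (A + (1 + k) * A) + (2 + k) * B           ≡⟨ cong₂ _+_ (cong (_+_ A) ([1+k]*[1+n]C[1+k]≡[1+n]*nCk n k))
                                                             ([1+k]*[1+n]C[1+k]≡[1+n]*nCk n (suc k)) ⟩
  A + (1 + n) * (n C k) + (1 + n) * (n C suc k) ≡⟨ +-assoc A _ _ ⟩
  A + ((1 + n) * (n C k) + (1 + n) * (n C suc k)) ≡⟨ cong (_+_ A) (*-distribˡ-+ (suc n) (n C k) (n C suc k)) ⟨
  A + (1 + n) * (n C k + n C suc k)         ≡⟨ cong (λ x → A + (1 + n) * x) (pascal n k) ⟨
  (2 + n) * A                               ∎
  where
  A = suc n C suc k
  B = suc n C suc (suc k)

[1+n]*2nC[1+n]≡n*2nCn : ∀ n → suc n * (2 * n C suc n) ≡ n * (2 * n C n)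
[1+n]*2nC[1+n]≡n*2nCn zero    = refl
[1+n]*2nC[1+n]≡n*2nCn (suc m) =
  subst (λ N → (2 + m) * (N C (2 + m)) ≡ (1 + m) * (N C (1 + m))) (sym (*-suc 2 m)) (begin
    (2 + m) * ((2 + 2 * m) C (2 + m)) ≡⟨ [1+k]*[1+n]C[1+k]≡[1+n]*nCk (suc (2 * m)) (suc m) ⟩
    (2 + 2 * m) * (suc (2 * m) C suc m) ≡⟨ cong ((2 + 2 * m) *_) ([1+2n]Cn≡[1+2n]C[1+n] m) ⟨
    (2 + 2 * m) * (suc (2 * m) C m)     ≡⟨ [1+k]*[1+n]C[1+k]≡[1+n]*nCk (suc (2 * m)) m ⟨
    (1 + m) * ((2 + 2 * m) C (1 + m)) ∎)

[1+n]*x≡n*y⇒y/[1+n]≡y∸x : ∀ {n x y} → suc n * x ≡ n * y → y / suc n ≡ y ∸ x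
[1+n]*x≡n*y⇒y/[1+n]≡y∸x {n} {x} {y} e = trans (cong (_/ suc n) (sym [y∸x]*[1+n]≡y)) (m*n/n≡m (y ∸ x) (suc n))
  where
  [y∸x]*[1+n]≡y : (y ∸ x) * suc n ≡ y
  [y∸x]*[1+n]≡y = begin
    (y ∸ x) * suc n         ≡⟨ *-comm (y ∸ x) (suc n) ⟩
    suc n * (y ∸ x)         ≡⟨ *-distribˡ-∸ (suc n) y x ⟩
    y + n * y ∸ suc n * x   ≡⟨ cong (y + n * y ∸_) e ⟩
    y + n * y ∸ n * y       ≡⟨ m+n∸n≡m y (n * y) ⟩
    y                       ∎

Cat≡[2nCn]∸[2nC[1+n]] : ∀ n → Cat n ≡ 2 * n C n ∸ 2 * n C suc n
Cat≡[2nCn]∸[2nC[1+n]] n = [1+n]*x≡n*y⇒y/[1+n]≡y∸x {n} {2 * n C suc n} ([1+n]*2nC[1+n]≡n*2nCn n)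

-- Differences of binomial coefficients

ΔC : ℕ → ℕ → ℕ → ℤ
ΔC N k d = + (N C k) ℤ.- + (N C (d + k))

ΔC-pascal : ∀ N k d → ΔC (suc N) (suc k) d ≡ ΔC N k d ℤ.+ ΔC N (suc k) d
ΔC-pascal N k d rewrite +-suc d k = begin
  + (suc N C suc k) ℤ.- + (suc N C suc (d + k))
    ≡⟨ cong₂ ℤ._-_ (pos-pascal k) (pos-pascal (d + k)) ⟩
  (+ (N C k) ℤ.+ + (N C suc k)) ℤ.- (+ (N C (d + k)) ℤ.+ + (N C suc (d + k)))
    ≡⟨ interchange (+ (N C k)) (+ (N C suc k)) (+ (N C (d + k))) (+ (N C suc (d + k))) ⟩
  ΔC N k d ℤ.+ (+ (N C suc k) ℤ.- + (N C suc (d + k))) ∎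
  where
  pos-pascal : ∀ j → + (suc N C suc j) ≡ + (N C j) ℤ.+ + (N C suc j)
  pos-pascal j = trans (cong +_ (pascal N j)) (pos-+ (N C j) (N C suc j))
  interchange : ∀ a b c e → (a ℤ.+ b) ℤ.- (c ℤ.+ e) ≡ (a ℤ.- c) ℤ.+ (b ℤ.- e)
  interchange = solve-∀

ΔC-trans : ∀ N k d e → ΔC N k d ℤ.+ ΔC N (d + k) e ≡ ΔC N k (e + d)
ΔC-trans N k d e rewrite sym (+-assoc e d k) = cancel (+ (N C k)) (+ (N C (d + k))) (+ (N C (e + d + k)))
  where
  cancel : ∀ a b c → (a ℤ.- b) ℤ.+ (b ℤ.- c) ≡ a ℤ.- c
  cancel = solve-∀

ΔC-centre : ∀ n → ΔC (suc (2 * n)) n 1 ≡ + 0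
ΔC-centre n = trans (cong (λ x → + x ℤ.- + (suc (2 * n) C suc n)) ([1+2n]Cn≡[1+2n]C[1+n] n))
                    (ℤ.+-inverseʳ (+ (suc (2 * n) C suc n)))

ΔC-row0 : ∀ k d → ΔC 0 (suc k) d ≡ + 0
ΔC-row0 k d
  rewrite +-suc d k | k>n⇒nCk≡0 {0} {suc k} (s≤s z≤n) | k>n⇒nCk≡0 {0} {suc (d + k)} (s≤s z≤n) = refl

ballot : ℕ → ℕ → ℕ → ℤ
ballot d n h = ΔC (2 * n) (h + n) d

+Cat≡ballot₁ : ∀ n → + Cat n ≡ ballot 1 n 0
+Cat≡ballot₁ n = begin
  + Cat n      ≡⟨ cong +_ (Cat≡[2nCn]∸[2nC[1+n]] n) ⟩
  + (Y ∸ X)    ≡⟨ ⊖-≥ X≤Y ⟨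
  Y ⊖ X        ≡⟨ m-n≡m⊖n Y X ⟨
  + Y ℤ.- + X  ∎
  where
  X = 2 * n C suc n
  Y = 2 * n C n
  X≤Y : X ≤ Y
  X≤Y = *-cancelˡ-≤ (suc n) (subst (_≤ suc n * Y) (sym ([1+n]*2nC[1+n]≡n*2nCn n)) (m≤n+m (n * Y) Y))

ballot-suc : ∀ d n h → ballot d (suc n) h ≡ ΔC (2 + 2 * n) (suc (h + n)) d
ballot-suc d n h = cong₂ (λ N k → ΔC N k d) (*-suc 2 n) (+-suc h n)

ballot-telescope : ∀ n h → ballot 1 n h ℤ.+ ballot 1 n (suc h) ≡ ballot 2 n h
ballot-telescope n h = ΔC-trans (2 * n) (h + n) 1 1

-- The recurrences list the contributions of a first step U, D, Hu, Hd in this order.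
ballot-suc-suc : ∀ d n h → ballot d (suc n) (suc h) ≡
  ballot d n (2 + h) ℤ.+ ballot d n h ℤ.+ ballot d n (1 + h) ℤ.+ ballot d n (1 + h)
ballot-suc-suc d n h = begin
  ballot d (suc n) (suc h)
    ≡⟨ ballot-suc d n (suc h) ⟩
  ΔC (2 + 2 * n) (2 + (h + n)) d
    ≡⟨ ΔC-pascal (suc (2 * n)) (suc (h + n)) d ⟩
  ΔC (1 + 2 * n) (1 + (h + n)) d ℤ.+ ΔC (1 + 2 * n) (2 + (h + n)) d
    ≡⟨ cong₂ ℤ._+_ (ΔC-pascal (2 * n) (h + n) d) (ΔC-pascal (2 * n) (suc (h + n)) d) ⟩
  (ballot d n h ℤ.+ ballot d n (1 + h)) ℤ.+ (ballot d n (1 + h) ℤ.+ ballot d n (2 + h))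
    ≡⟨ rearrange (ballot d n h) (ballot d n (1 + h)) (ballot d n (2 + h)) ⟩
  _ ∎
  where
  rearrange : ∀ a b c → (a ℤ.+ b) ℤ.+ (b ℤ.+ c) ≡ c ℤ.+ a ℤ.+ b ℤ.+ b
  rearrange = solve-∀

ballot₁-suc-suc : ∀ n h → ballot 1 (suc n) (suc h) ≡ ballot 2 n h ℤ.+ ballot 2 n (suc h)
ballot₁-suc-suc n h = begin
  ballot 1 (suc n) (suc h)
    ≡⟨ ballot-suc 1 n (suc h) ⟩
  ΔC (2 + 2 * n) (2 + (h + n)) 1
    ≡⟨ ΔC-pascal (suc (2 * n)) (suc (h + n)) 1 ⟩
  ΔC (1 + 2 * n) (1 + (h + n)) 1 ℤ.+ ΔC (1 + 2 * n) (2 + (h + n)) 1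
    ≡⟨ ΔC-trans (suc (2 * n)) (suc (h + n)) 1 1 ⟩
  ΔC (1 + 2 * n) (1 + (h + n)) 2
    ≡⟨ ΔC-pascal (2 * n) (h + n) 2 ⟩
  ballot 2 n h ℤ.+ ballot 2 n (suc h) ∎

ballot₁-suc-zero : ∀ n → ballot 1 (suc n) 0 ≡ ballot 1 n 0 ℤ.+ ballot 1 n 1
ballot₁-suc-zero n = begin
  ballot 1 (suc n) 0
    ≡⟨ ballot-suc 1 n 0 ⟩
  ΔC (2 + 2 * n) (suc n) 1
    ≡⟨ ΔC-pascal (suc (2 * n)) n 1 ⟩
  ΔC (1 + 2 * n) n 1 ℤ.+ ΔC (1 + 2 * n) (suc n) 1
    ≡⟨ cong (ℤ._+ ΔC (1 + 2 * n) (suc n) 1) (ΔC-centre n) ⟩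
  + 0 ℤ.+ ΔC (1 + 2 * n) (suc n) 1
    ≡⟨ ℤ.+-identityˡ _ ⟩
  ΔC (1 + 2 * n) (suc n) 1
    ≡⟨ ΔC-pascal (2 * n) n 1 ⟩
  ballot 1 n 0 ℤ.+ ballot 1 n 1 ∎

ballot₂-suc-zero : ∀ n → ballot 2 (suc n) 0 ≡ ballot 2 n 1 ℤ.+ + 0 ℤ.+ ballot 2 n 0 ℤ.+ ballot 2 n 0
ballot₂-suc-zero n = begin
  ballot 2 (suc n) 0
    ≡⟨ ballot-telescope (suc n) 0 ⟨
  ballot 1 (suc n) 0 ℤ.+ ballot 1 (suc n) 1
    ≡⟨ cong₂ ℤ._+_ (ballot₁-suc-zero n) (ballot₁-suc-suc n 0) ⟩
  (ballot 1 n 0 ℤ.+ ballot 1 n 1) ℤ.+ (ballot 2 n 0 ℤ.+ ballot 2 n 1)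
    ≡⟨ cong (ℤ._+ (ballot 2 n 0 ℤ.+ ballot 2 n 1)) (ballot-telescope n 0) ⟩
  ballot 2 n 0 ℤ.+ (ballot 2 n 0 ℤ.+ ballot 2 n 1)
    ≡⟨ rearrange (ballot 2 n 0) (ballot 2 n 1) ⟩
  ballot 2 n 1 ℤ.+ + 0 ℤ.+ ballot 2 n 0 ℤ.+ ballot 2 n 0 ∎
  where
  rearrange : ∀ a b → a ℤ.+ (a ℤ.+ b) ≡ b ℤ.+ + 0 ℤ.+ a ℤ.+ a
  rearrange = solve-∀

ballot₂-suc : ∀ n h → ballot 2 (suc n) h ≡ ballot 2 n (suc h) ℤ.+ ballot 1 (suc n) h ℤ.+ ballot 2 n h ℤ.+ + 0
ballot₂-suc n h = begin
  ballot 2 (suc n) h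
    ≡⟨ ballot-telescope (suc n) h ⟨
  ballot 1 (suc n) h ℤ.+ ballot 1 (suc n) (suc h)
    ≡⟨ cong (ℤ._+_ (ballot 1 (suc n) h)) (ballot₁-suc-suc n h) ⟩
  ballot 1 (suc n) h ℤ.+ (ballot 2 n h ℤ.+ ballot 2 n (suc h))
    ≡⟨ rearrange (ballot 1 (suc n) h) (ballot 2 n h) (ballot 2 n (suc h)) ⟩
  _ ∎
  where
  rearrange : ∀ a b c → a ℤ.+ (b ℤ.+ c) ≡ c ℤ.+ a ℤ.+ b ℤ.+ + 0
  rearrange = solve-∀

-- Counting paths by starting height

+count-suc : ∀ P n → + count P (suc n) ≡
  + count (P ∘ (U ∷_)) n ℤ.+ + count (P ∘ (D ∷_)) n ℤ.+ + count (P ∘ (Hu ∷_)) n ℤ.+ + count (P ∘ (Hd ∷_)) n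
+count-suc P n = trans (cong +_ (count-suc P n))
  (trans (pos-+ _ cHd) (cong (ℤ._+ + cHd) (trans (pos-+ _ cHu) (cong (ℤ._+ + cHu) (pos-+ cU cD)))))
  where
  cU = count (P ∘ (U ∷_)) n
  cD = count (P ∘ (D ∷_)) n
  cHu = count (P ∘ (Hu ∷_)) n
  cHd = count (P ∘ (Hd ∷_)) n

+count-none : ∀ {P} → (∀ w → P w ≡ false) → ∀ n → + count P n ≡ + 0
+count-none P≡false n = cong +_ (count-none P≡false n)

+-cong₄ : ∀ {a b c d a′ b′ c′ d′ : ℤ} → a ≡ a′ → b ≡ b′ → c ≡ c′ → d ≡ d′ →
          a ℤ.+ b ℤ.+ c ℤ.+ d ≡ a′ ℤ.+ b′ ℤ.+ c′ ℤ.+ d′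
+-cong₄ a≡a′ b≡b′ c≡c′ d≡d′ = cong₂ ℤ._+_ (cong₂ ℤ._+_ (cong₂ ℤ._+_ a≡a′ b≡b′) c≡c′) d≡d′

motz₁From motz₂From motz₁₂From : ℕ → List Step → Bool
motz₁From h w = validFrom h w ∧ noUmberAt0From h w
motz₂From h w = validFrom h w ∧ restr2 w
motz₁₂From h w = validFrom h w ∧ (noUmberAt0From h w ∧ restr2 w)

+count-validFrom : ∀ n h → + count (validFrom h) n ≡ ballot 2 n h
+count-validFrom zero    zero    = refl
+count-validFrom zero    (suc h) = sym (ΔC-row0 (h + 0) 2)
+count-validFrom (suc n) zero    = begin
  + count (validFrom 0) (suc n)
    ≡⟨ +count-suc (validFrom 0) n ⟩
  _ ≡⟨ +-cong₄ (+count-validFrom n 1) (+count-none (λ _ → refl) n) (+count-validFrom n 0) (+count-validFrom n 0) ⟩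
  _ ≡⟨ ballot₂-suc-zero n ⟨
  ballot 2 (suc n) 0 ∎
+count-validFrom (suc n) (suc h) = begin
  + count (validFrom (suc h)) (suc n)
    ≡⟨ +count-suc (validFrom (suc h)) n ⟩
  _ ≡⟨ +-cong₄ (+count-validFrom n (2 + h)) (+count-validFrom n h)
               (+count-validFrom n (1 + h)) (+count-validFrom n (1 + h)) ⟩
  _ ≡⟨ ballot-suc-suc 2 n h ⟨
  ballot 2 (suc n) (suc h) ∎

+count-motz₁From : ∀ n h → + count (motz₁From h) n ≡ ballot 1 n h
+count-motz₁From zero    zero    = refl
+count-motz₁From zero    (suc h) = sym (ΔC-row0 (h + 0) 1)
+count-motz₁From (suc n) zero    = begin
  + count (motz₁From 0) (suc n)
    ≡⟨ +count-suc (motz₁From 0) n ⟩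
  _ ≡⟨ +-cong₄ (+count-motz₁From n 1) (+count-none (λ _ → refl) n)
               (+count-none (λ w → ∧-zeroʳ (validFrom 0 w)) n) (+count-motz₁From n 0) ⟩
  ballot 1 n 1 ℤ.+ + 0 ℤ.+ + 0 ℤ.+ ballot 1 n 0
    ≡⟨ rearrange (ballot 1 n 0) (ballot 1 n 1) ⟩
  ballot 1 n 0 ℤ.+ ballot 1 n 1
    ≡⟨ ballot₁-suc-zero n ⟨
  ballot 1 (suc n) 0 ∎
  where
  rearrange : ∀ a b → b ℤ.+ + 0 ℤ.+ + 0 ℤ.+ a ≡ a ℤ.+ b
  rearrange = solve-∀
+count-motz₁From (suc n) (suc h) = begin
  + count (motz₁From (suc h)) (suc n)
    ≡⟨ +count-suc (motz₁From (suc h)) n ⟩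
  _ ≡⟨ +-cong₄ (+count-motz₁From n (2 + h)) (+count-motz₁From n h)
               (+count-motz₁From n (1 + h)) (+count-motz₁From n (1 + h)) ⟩
  _ ≡⟨ ballot-suc-suc 1 n h ⟨
  ballot 1 (suc n) (suc h) ∎

+count-motz₂From : ∀ n h → + count (motz₂From h) n ≡ ballot 1 n h
+count-motz₂From zero    zero    = refl
+count-motz₂From zero    (suc h) = sym (ΔC-row0 (h + 0) 1)
+count-motz₂From (suc n) zero    = begin
  + count (motz₂From 0) (suc n)
    ≡⟨ +count-suc (motz₂From 0) n ⟩
  _ ≡⟨ +-cong₄ (+count-motz₂From n 1) (+count-none (λ _ → refl) n)
               (+count-motz₂From n 0) (+count-none (λ w → ∧-zeroʳ (validFrom 0 w)) n) ⟩
  ballot 1 n 1 ℤ.+ + 0 ℤ.+ ballot 1 n 0 ℤ.+ + 0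
    ≡⟨ rearrange (ballot 1 n 0) (ballot 1 n 1) ⟩
  ballot 1 n 0 ℤ.+ ballot 1 n 1
    ≡⟨ ballot₁-suc-zero n ⟨
  ballot 1 (suc n) 0 ∎
  where
  rearrange : ∀ a b → b ℤ.+ + 0 ℤ.+ a ℤ.+ + 0 ≡ a ℤ.+ b
  rearrange = solve-∀
+count-motz₂From (suc n) (suc h) = begin
  + count (motz₂From (suc h)) (suc n)
    ≡⟨ +count-suc (motz₂From (suc h)) n ⟩
  _ ≡⟨ +-cong₄ (+count-motz₂From n (2 + h))
               (trans (cong +_ (count-≗ (λ w → ∧-identityʳ (validFrom h w)) n)) (+count-validFrom n h))
               (+count-motz₂From n (1 + h)) (+count-none (λ w → ∧-zeroʳ (validFrom (suc h) w)) n) ⟩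
  ballot 1 n (2 + h) ℤ.+ ballot 2 n h ℤ.+ ballot 1 n (1 + h) ℤ.+ + 0
    ≡⟨ rearrange (ballot 2 n h) (ballot 1 n (1 + h)) (ballot 1 n (2 + h)) ⟩
  ballot 2 n h ℤ.+ (ballot 1 n (1 + h) ℤ.+ ballot 1 n (2 + h))
    ≡⟨ cong (ℤ._+_ (ballot 2 n h)) (ballot-telescope n (suc h)) ⟩
  ballot 2 n h ℤ.+ ballot 2 n (1 + h)
    ≡⟨ ballot₁-suc-suc n h ⟨
  ballot 1 (suc n) (suc h) ∎
  where
  rearrange : ∀ a b c → c ℤ.+ a ℤ.+ b ℤ.+ + 0 ≡ a ℤ.+ (b ℤ.+ c)
  rearrange = solve-∀

+count-motz₁₂From : ∀ n h → + count (motz₁₂From (suc h)) (suc n) ≡ ballot 2 n h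
+count-motz₁₂From zero    zero    = refl
+count-motz₁₂From zero    (suc h) = sym (ΔC-row0 (h + 0) 2)
+count-motz₁₂From (suc n) h       = begin
  + count (motz₁₂From (suc h)) (2 + n)
    ≡⟨ +count-suc (motz₁₂From (suc h)) (suc n) ⟩
  _ ≡⟨ +-cong₄ (+count-motz₁₂From n (suc h))
               (trans (cong +_ (count-≗ (λ w → cong (validFrom h w ∧_) (∧-identityʳ (noUmberAt0From h w))) (suc n)))
                      (+count-motz₁From (suc n) h))
               (+count-motz₁₂From n h)
               (+count-none (λ w → trans (cong (validFrom (suc h) w ∧_) (∧-zeroʳ (noUmberAt0From (suc h) w)))
                                         (∧-zeroʳ (validFrom (suc h) w))) (suc n)) ⟩
  _ ≡⟨ ballot₂-suc n h ⟨
  ballot 2 (suc n) h ∎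

countMotz≡Cat[1+n] : ∀ n → countMotz n ≡ Cat (suc n)
countMotz≡Cat[1+n] n = +-injective (begin
  + countMotz n                  ≡⟨ +count-validFrom n 0 ⟩
  ballot 2 n 0                   ≡⟨ ballot-telescope n 0 ⟨
  ballot 1 n 0 ℤ.+ ballot 1 n 1  ≡⟨ ballot₁-suc-zero n ⟨
  ballot 1 (suc n) 0             ≡⟨ +Cat≡ballot₁ (suc n) ⟨
  + Cat (suc n)                  ∎)

countMotz1≡Cat : ∀ n → countMotz1 n ≡ Cat n
countMotz1≡Cat n = +-injective (trans (+count-motz₁From n 0) (sym (+Cat≡ballot₁ n)))

countMotz2≡Cat : ∀ n → countMotz2 n ≡ Cat n
countMotz2≡Cat n = +-injective (trans (+count-motz₂From n 0) (sym (+Cat≡ballot₁ n)))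

countMotz12[2+n]≡countMotz[n] : ∀ n → countMotz12 (2 + n) ≡ countMotz n
countMotz12[2+n]≡countMotz[n] n = +-injective (begin
  + countMotz12 (2 + n)
    ≡⟨ +count-suc (motz₁₂From 0) (suc n) ⟩
  _ ≡⟨ +-cong₄ (+count-motz₁₂From n 0) (+count-none (λ _ → refl) (suc n))
               (+count-none (λ w → ∧-zeroʳ (validFrom 0 w)) (suc n))
               (+count-none (λ w → trans (cong (validFrom 0 w ∧_) (∧-zeroʳ (noUmberAt0From 0 w)))
                                         (∧-zeroʳ (validFrom 0 w))) (suc n)) ⟩
  ballot 2 n 0 ℤ.+ + 0 ℤ.+ + 0 ℤ.+ + 0
    ≡⟨ drop-zeros (ballot 2 n 0) ⟩
  ballot 2 n 0
    ≡⟨ +count-validFrom n 0 ⟨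
  + countMotz n ∎)
  where
  drop-zeros : ∀ a → a ℤ.+ + 0 ℤ.+ + 0 ℤ.+ + 0 ≡ a
  drop-zeros = solve-∀

proposition12 : (∀ (n : ℕ) → countMotz n ≡ Cat (suc n) × countMotz1 n ≡ Cat n × countMotz2 n ≡ Cat n)
    × (∀ (n : ℕ) → n ≥ 2 → countMotz12 n ≡ Cat (n ∸ 1))
proposition12 =
  (λ n → countMotz≡Cat[1+n] n , countMotz1≡Cat n , countMotz2≡Cat n) ,
  λ { (suc (suc n)) (s≤s (s≤s _)) → trans (countMotz12[2+n]≡countMotz[n] n) (countMotz≡Cat[1+n] n) }
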